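{- Let $G$ be a finite undirected connected graph without loops with vertices $v_1,\dots,v_{n+1}$ and sink $v_{n+1}$. For every $c\in\mathsf{Stable}(G)$, one has $\psi(c)=c$ if and only if $c$ is recurrent. That is, the fixed points of $\psi$ are exactly the recurrent configurations of $G$.
   Context: $e(i,j)\in\{0,1\}$ indicates an edge between $v_i$ and $v_j$, and $d_i$ is the degree of $v_i$. Let $\alpha_i$ be the $i$-th standard basis vector of $\mathbb{Z}^{n+1}$ and define the toppling vectors $\Delta_i=d_i\alpha_i-\sum_{j\neq i}e(i,j)\alpha_j$ for $1\le i\le n+1$. For $A\subseteq\{1,\dots,n+1\}$ put $\Delta_A=\sum_{j\in A}\Delta_j$ (with $\Delta_\emptyset=0$). A configuration is a vector $c\in\mathbb{Z}^{n+1}$, considered modulo its sink coordinate (two configurations are equal if they agree at $v_1,\dots,v_n$). A configuration $c$ is non-negative if $c_i\ge 0$ for $1\le i\le n$, and stable if in addition $c_i<d_i$ for $1\le i\le n$. $\mathsf{Stable}(G)$ denotes the set of stable configurations. A stable $c$ is recurrent if there is a permutation $(a_1,\dots,a_n)$ of $\{1,\dots,n\}$ such that $c-\Delta_{n+1}-\sum_{j=1}^{i}\Delta_{a_j}$ is non-negative for every $i=0,1,\dots,n$ (i.e. after toppling the sink one can topple every other vertex exactly once, each toppling being legal). Order the subsets of $\{1,\dots,n\}$ by $A\prec B$ if $|A|<|B|$, or $|A|=|B|$ and the increasing listing of $A$ is lexicographically smaller than that of $B$. For $c\in\mathsf{Stable}(G)$, $\psi(c)=c$ if $c+\Delta_A\notin\mathsf{Stable}(G)$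 for every nonempty $A\subseteq\{1,\dots,n\}$; otherwise $\psi(c)=c+\Delta_A$ where $A$ is the $\prec$-minimal nonempty subset of $\{1,\dots,n\}$ with $c+\Delta_A\in\mathsf{Stable}(G)$. -}

module Defs where

open import Data.Nat as ℕ using (ℕ; zero; suc)
open import Data.Integer as ℤ using (ℤ; +_; _+_; _-_; -_; _≤_; _<_; 0ℤ)
import Data.Integer.Properties as ℤP
open import Data.Bool using (Bool; true; false; if_then_else_; _∧_; _∨_; not)
open import Data.Fin using (Fin; inject₁; fromℕ; toℕ; _≟_)
open import Data.Fin.Permutation using (Permutation′; _⟨$⟩ʳ_)
open import Data.List using (List; []; _∷_; map; foldr; take; allFin; length; filter; filterᵇ)
open import Data.Maybe using (Maybe; just; nothing)
open import Data.Product using (_×_; Σ; _,_)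
open import Data.Vec using (Vec; []; _∷_)
open import Relation.Nullary using (¬_; Dec; yes; no; does)
open import Relation.Binary.PropositionalEquality using (_≡_)
open import Data.Fin.Subset using (Subset; inside; outside; _∈_; Nonempty)

-- Graphs on vertices v_1 … v_{n+1} = Fin (suc n); the sink v_{n+1} is
-- `fromℕ n`, and v_i (1 ≤ i ≤ n) is `inject₁ i` for i : Fin n.

data Reach {m : ℕ} (e : Fin m → Fin m → Bool) : Fin m → Fin m → Set where
  here  : ∀ {i} → Reach e i i
  step  : ∀ {i j k} → e i j ≡ true → Reach e j k → Reach e i k

record Graph (n : ℕ) : Set where
  field
    e         : Fin (suc n) → Fin (suc n) → Bool
    symmetric : ∀ i j → e i j ≡ e j i
    loopless  : ∀ i → e i i ≡ false
    connected : ∀ i j → Reach e i j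

module _ {n : ℕ} (G : Graph n) where
  open Graph G

  Config : Set
  Config = Fin (suc n) → ℤ

  eℕ : Fin (suc n) → Fin (suc n) → ℕ
  eℕ i j = if e i j then 1 else 0

  sumℕ : List ℕ → ℕ
  sumℕ = foldr ℕ._+_ 0

  deg : Fin (suc n) → ℕ
  deg i = sumℕ (map (eℕ i) (allFin (suc n)))

  Δ : Fin (suc n) → Config
  Δ i j with does (i ≟ j)
  ... | true  = + deg i
  ... | false = - (+ eℕ i j)

  zeroC : Config
  zeroC _ = 0ℤ

  _⊕_ : Config → Config → Config
  (c ⊕ c') j = c j + c' j

  _⊖_ : Config → Config → Config
  (c ⊖ c') j = c j - c' j

  sumC : List Config → Config
  sumC = foldr _⊕_ zeroC

  members : Subset n → List (Fin n)
  members A = filter (λ i → i ∈? A) (allFin n)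
    where
    _∈?_ : (i : Fin n) (A : Subset n) → Dec (i ∈ A)
    i ∈? A = Data.Fin.Subset.Properties._∈?_ i A
      where import Data.Fin.Subset.Properties

  ΔS : Subset n → Config
  ΔS A = sumC (map (λ i → Δ (inject₁ i)) (members A))

  sink : Fin (suc n)
  sink = fromℕ n

  _≈_ : Config → Config → Set
  c ≈ c' = ∀ (i : Fin n) → c (inject₁ i) ≡ c' (inject₁ i)

  NonNegative : Config → Set
  NonNegative c = ∀ (i : Fin n) → 0ℤ ≤ c (inject₁ i)

  Stable : Config → Set
  Stable c = ∀ (i : Fin n) → (0ℤ ≤ c (inject₁ i)) × (c (inject₁ i) < + deg (inject₁ i))

  stableᵇ : Config → Bool
  stableᵇ c = foldr (λ i b → does (0ℤ ℤP.≤? c (inject₁ i)) ∧ does (c (inject₁ i) ℤP.<? + deg (inject₁ i)) ∧ b) true (allFin n)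

  Recurrent : Config → Set
  Recurrent c = Stable c × Σ (Permutation′ n) λ a →
    ∀ (i : Fin (suc n)) →
      NonNegative ((c ⊖ Δ sink) ⊖ sumC (take (toℕ i) (map (λ j → Δ (inject₁ (a ⟨$⟩ʳ j))) (allFin n))))

  lexLtᵇ : List ℕ → List ℕ → Bool
  lexLtᵇ []       []       = false
  lexLtᵇ []       (_ ∷ _)  = true
  lexLtᵇ (_ ∷ _)  []       = false
  lexLtᵇ (x ∷ xs) (y ∷ ys) = (x ℕ.<ᵇ y) ∨ ((x ℕ.≡ᵇ y) ∧ lexLtᵇ xs ys)

  _≺ᵇ_ : Subset n → Subset n → Bool
  A ≺ᵇ B = (length (members A) ℕ.<ᵇ length (members B))
         ∨ ((length (members A) ℕ.≡ᵇ length (members B))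
            ∧ lexLtᵇ (map toℕ (members A)) (map toℕ (members B)))

  nonemptyᵇ : Subset n → Bool
  nonemptyᵇ A with members A
  ... | []    = false
  ... | _ ∷ _ = true

  allSubsets : ∀ m → List (Subset m)
  allSubsets zero    = [] ∷ []
  allSubsets (suc m) = map (outside ∷_) (allSubsets m) Data.List.++ map (inside ∷_) (allSubsets m)

  minimum≺ : List (Subset n) → Maybe (Subset n)
  minimum≺ []       = nothing
  minimum≺ (A ∷ As) with minimum≺ As
  ... | nothing = just A
  ... | just B  = if B ≺ᵇ A then just B else just A

  ψ : Config → Config
  ψ c with minimum≺ (filterᵇ (λ A → nonemptyᵇ A ∧ stableᵇ (c ⊕ ΔS A)) (allSubsets n))
  ... | nothing = c
  ... | just A  = c ⊕ ΔS A

-- Call a nonempty A ⊆ {v₁,…,vₙ} a candidate for c when c + Δ_A is stable. ψ moves c exactly when a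
-- candidate exists, because Δ_A never vanishes off the sink: at v ∈ A it counts the edges from v
-- leaving A, and by connectivity some vertex of A has one.
--
-- A recurrent c has no candidate A: when the first vertex v of A in the toppling order topples, it
-- has received chips only from the sink and from outside A, which forces (c + Δ_A)(v) ≥ d_v.
-- Conversely, without candidates the burning algorithm succeeds: if, after the sink and a set P
-- have toppled, no vertex outside P can topple, then c + Δ_{∁P}, which equals c − Δ_sink − Δ_P
-- off the sink, is stable, so ∁P is a candidate.

module Submission where

open import Defs
open import Data.Bool using (Bool; true; false; T; not; if_then_else_; _∧_)
open import Data.Bool.Properties using (T-∧; T-≡)
open import Data.Empty using (⊥-elim)
open import Data.Fin as Fin using (Fin; zero; suc; inject₁; fromℕ<; toℕ; inject; lower₁)
import Data.Fin.Properties as Finₚ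
open import Data.Fin.Permutation as Perm using (Permutation′; _⟨$⟩ʳ_; _⟨$⟩ˡ_; _∘ₚ_)
import Data.Fin.Permutation.Components as PC
open import Data.Fin.Subset using (Subset; Nonempty; _∈_)
import Data.Fin.Subset.Properties as Subsetₚ
open import Data.Integer as ℤ using (ℤ; +_; _+_; _-_; -_; 0ℤ; 1ℤ; _≤_; _<_)
import Data.Integer.Properties as ℤₚ
open import Data.Integer.Tactic.RingSolver using (solve-∀)
open import Data.List using (List; []; _∷_; map; foldr; take; tabulate; filter; filterᵇ; allFin)
import Data.List.Properties as Listₚ
open import Data.List.Membership.Propositional using () renaming (_∈_ to _∈ˡ_)
open import Data.List.Membership.Propositional.Properties
  using (∈-filter⁺; ∈-filter⁻; ∈-allFin; ∈-map⁺; ∈-++⁺ˡ; ∈-++⁺ʳ)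
open import Data.List.Relation.Unary.All using (All; []; _∷_)
open import Data.List.Relation.Unary.All.Properties using (tabulate⁺; tabulate⁻)
open import Data.List.Relation.Unary.Any using (here; there)
open import Data.Maybe using (just; nothing)
import Data.Maybe.Properties as Maybeₚ
open import Data.Nat as ℕ using (ℕ)
import Data.Nat.Properties as ℕₚ
open import Data.Product using (Σ; ∃; _×_; _,_; proj₁; proj₂)
open import Data.Sum using (_⊎_; inj₁; inj₂)
open import Data.Vec as Vec using (lookup)
open import Data.Vec.Properties using ([]=⇒lookup; lookup⇒[]=; lookup∘tabulate)
open import Function using (_∘_; const)
open import Function.Bundles using (_⇔_; mk⇔; Equivalence)
open import Relation.Nullary using (¬_; Dec; yes; no; does; contradiction)
open import Relation.Nullary.Decidable using (dec-true; dec-false; ¬?; _×-dec_; decidable-stable; T?)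
open import Relation.Unary using (Decidable)
open import Relation.Binary.PropositionalEquality

import Algebra.Properties.CommutativeMonoid.Sum ℤₚ.+-0-commutativeMonoid as Sum
open Sum using (sum; sum-cong-≗)

-- Sums over Fin m

+-≡⇒≡- : ∀ {x y z} → x + y ≡ z → x ≡ z - y
+-≡⇒≡- {x} {y} refl = x≡x+y-y x y
  where
  x≡x+y-y : ∀ x y → x ≡ x + y - y
  x≡x+y-y = solve-∀

x+y≡x⇒y≡0 : ∀ {x y} → x + y ≡ x → y ≡ 0ℤ
x+y≡x⇒y≡0 {x} {y} eq = trans (+-≡⇒≡- (trans (ℤₚ.+-comm y x) eq)) (ℤₚ.+-inverseʳ x)

sum-mono-≤ : ∀ {m} {f g : Fin m → ℤ} → (∀ i → f i ≤ g i) → sum f ≤ sum g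
sum-mono-≤ {ℕ.zero}  f≤g = ℤₚ.≤-refl
sum-mono-≤ {ℕ.suc m} f≤g = ℤₚ.+-mono-≤ (f≤g zero) (sum-mono-≤ (f≤g ∘ suc))

sum-nonneg : ∀ {m} {f : Fin m → ℤ} → (∀ i → 0ℤ ≤ f i) → 0ℤ ≤ sum f
sum-nonneg {m} {f} 0≤f = subst (_≤ sum f) (Sum.sum-replicate-zero m) (sum-mono-≤ 0≤f)

sum-indicator : ∀ {m} (i : Fin m) (a : ℤ) → sum (λ j → if does (j Fin.≟ i) then a else 0ℤ) ≡ a
sum-indicator {ℕ.suc m} zero    a = trans (cong (_+_ a) (Sum.sum-replicate-zero m)) (ℤₚ.+-identityʳ a)
sum-indicator {ℕ.suc m} (suc i) a = trans (ℤₚ.+-identityˡ _) (sum-indicator i a)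

term≤sum : ∀ {m} {f : Fin m → ℤ} → (∀ i → 0ℤ ≤ f i) → ∀ i → f i ≤ sum f
term≤sum {f = f} 0≤f i = subst (_≤ sum f) (sum-indicator i (f i)) (sum-mono-≤ below)
  where
  below : ∀ j → (if does (j Fin.≟ i) then f i else 0ℤ) ≤ f j
  below j with j Fin.≟ i
  ... | yes refl = ℤₚ.≤-refl
  ... | no _     = 0≤f j

if-T : ∀ {A : Set} {b} {x y : A} → T b → (if b then x else y) ≡ x
if-T {b = true} _ = refl

_⊆ᵇ_ : ∀ {m} → (Fin m → Bool) → (Fin m → Bool) → Set
P ⊆ᵇ Q = ∀ i → T (P i) → T (Q i)

sumOver : ∀ {m} → (Fin m → Bool) → (Fin m → ℤ) → ℤ
sumOver P f = sum (λ i → if P i then f i else 0ℤ)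

module _ {m} {f : Fin m → ℤ} (0≤f : ∀ i → 0ℤ ≤ f i) where

  restricted-nonneg : ∀ (P : Fin m → Bool) i → 0ℤ ≤ (if P i then f i else 0ℤ)
  restricted-nonneg P i with P i
  ... | true  = 0≤f i
  ... | false = ℤₚ.≤-refl

  sumOver-nonneg : ∀ P → 0ℤ ≤ sumOver P f
  sumOver-nonneg P = sum-nonneg (restricted-nonneg P)

  sumOver-mono : ∀ {P Q} → P ⊆ᵇ Q → sumOver P f ≤ sumOver Q f
  sumOver-mono {P} {Q} P⊆Q = sum-mono-≤ term
    where
    term : ∀ i → (if P i then f i else 0ℤ) ≤ (if Q i then f i else 0ℤ)
    term i with P i | Q i | P⊆Q i
    ... | true  | true  | _    = ℤₚ.≤-refl
    ... | true  | false | P⇒Q = ⊥-elim (P⇒Q _)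
    ... | false | true  | _    = 0≤f i
    ... | false | false | _    = ℤₚ.≤-refl

  term≤sumOver : ∀ {P} i → T (P i) → f i ≤ sumOver P f
  term≤sumOver {P} i Pi = subst (_≤ sumOver P f) (if-T Pi) (term≤sum (restricted-nonneg P) i)

  sumOver-disjoint : ∀ {P Q} → (∀ i → T (P i) → T (Q i) → f i ≡ 0ℤ) →
                     sumOver P f + sumOver Q f ≤ sum f
  sumOver-disjoint {P} {Q} vanish =
    subst (_≤ sum f) (Sum.∑-distrib-+ (λ i → if P i then f i else 0ℤ) _) (sum-mono-≤ term)
    where
    term : ∀ i → (if P i then f i else 0ℤ) + (if Q i then f i else 0ℤ) ≤ f i
    term i with P i | Q i | vanish i
    ... | true  | true  | f≡0 rewrite f≡0 _ _ = ℤₚ.≤-refl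
    ... | true  | false | _   = ℤₚ.≤-reflexive (ℤₚ.+-identityʳ _)
    ... | false | true  | _   = ℤₚ.≤-reflexive (ℤₚ.+-identityˡ _)
    ... | false | false | _   = 0≤f i

sumOver-complement : ∀ {m} P (f : Fin m → ℤ) → sumOver P f + sumOver (not ∘ P) f ≡ sum f
sumOver-complement P f =
  trans (sym (Sum.∑-distrib-+ (λ i → if P i then f i else 0ℤ) _)) (sum-cong-≗ term)
  where
  term : ∀ i → (if P i then f i else 0ℤ) + (if not (P i) then f i else 0ℤ) ≡ f i
  term i with P i
  ... | true  = ℤₚ.+-identityʳ (f i)
  ... | false = ℤₚ.+-identityˡ (f i)

sumOver-cong : ∀ {m} {P Q} (f : Fin m → ℤ) → (∀ i → P i ≡ Q i) → sumOver P f ≡ sumOver Q f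
sumOver-cong f P≗Q = sum-cong-≗ (λ i → cong (λ b → if b then f i else 0ℤ) (P≗Q i))

sumᴸ : List ℤ → ℤ
sumᴸ = foldr _+_ 0ℤ

sumᴸ-filter : ∀ {A : Set} {P : A → Set} (P? : Decidable P) {m} (g : A → ℤ) (f : Fin m → A) →
              sumᴸ (map g (filter P? (tabulate f)))
                ≡ sum (λ i → if does (P? (f i)) then g (f i) else 0ℤ)
sumᴸ-filter P? {ℕ.zero}  g f = refl
sumᴸ-filter P? {ℕ.suc m} g f with does (P? (f zero))
... | true  = cong (_+_ (g (f zero))) (sumᴸ-filter P? g (f ∘ suc))
... | false = trans (sumᴸ-filter P? g (f ∘ suc)) (sym (ℤₚ.+-identityˡ _))

sumᴸ-take : ∀ {A : Set} {m} k (g : A → ℤ) (f : Fin m → A) →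
            sumᴸ (map g (take k (tabulate f))) ≡ sum (λ i → if toℕ i ℕ.<ᵇ k then g (f i) else 0ℤ)
sumᴸ-take {m = ℕ.zero}  ℕ.zero    g f = refl
sumᴸ-take {m = ℕ.zero}  (ℕ.suc k) g f = refl
sumᴸ-take {m = ℕ.suc m} ℕ.zero    g f = sym (trans (ℤₚ.+-identityˡ _) (Sum.sum-replicate-zero m))
sumᴸ-take {m = ℕ.suc m} (ℕ.suc k) g f = cong (_+_ (g (f zero))) (sumᴸ-take k g (f ∘ suc))

pos-sumℕ : ∀ {A : Set} {m} (h : A → ℕ) (f : Fin m → A) →
         + foldr ℕ._+_ 0 (map h (tabulate f)) ≡ sum (λ i → + h (f i))
pos-sumℕ {m = ℕ.zero}  h f = refl
pos-sumℕ {m = ℕ.suc m} h f =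
  trans (ℤₚ.pos-+ (h (f zero)) _) (cong (_+_ (+ h (f zero))) (pos-sumℕ h (f ∘ suc)))

-- Transpositions and prefixes of a permutation

≤⇒≮ᵇ : ∀ {i k} → k ℕ.≤ i → (i ℕ.<ᵇ k) ≡ false
≤⇒≮ᵇ {i} {k} k≤i with i ℕ.<ᵇ k in eq
... | false = refl
... | true  = contradiction (ℕₚ.<ᵇ⇒< i k (subst T (sym eq) _)) (ℕₚ.≤⇒≯ k≤i)

transpose-≢ : ∀ {m} {a b x : Fin m} → x ≢ a → x ≢ b → PC.transpose a b x ≡ x
transpose-≢ {a = a} {b} {x} x≢a x≢b
  rewrite dec-false (x Fin.≟ a) x≢a | dec-false (x Fin.≟ b) x≢b = refl

transpose-matchˡ : ∀ {m} (a b : Fin m) → PC.transpose a b a ≡ b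
transpose-matchˡ a b rewrite dec-true (a Fin.≟ a) refl = refl

transpose-<ᵇ : ∀ {m k} {a b : Fin m} → k ℕ.≤ toℕ a → k ℕ.≤ toℕ b →
               ∀ x → (toℕ (PC.transpose a b x) ℕ.<ᵇ k) ≡ (toℕ x ℕ.<ᵇ k)
transpose-<ᵇ {a = a} {b} k≤a k≤b x with x Fin.≟ a
... | yes refl = trans (≤⇒≮ᵇ k≤b) (sym (≤⇒≮ᵇ k≤a))
... | no _ with x Fin.≟ b
...   | yes refl = trans (≤⇒≮ᵇ k≤a) (sym (≤⇒≮ᵇ k≤b))
...   | no _     = refl

prefix : ∀ {m} → Permutation′ m → ℕ → Fin m → Bool
prefix π k w = toℕ (π ⟨$⟩ˡ w) ℕ.<ᵇ k

prefix-mono : ∀ {m} (π : Permutation′ m) {i k} → i ℕ.≤ k → prefix π i ⊆ᵇ prefix π k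
prefix-mono π {i} {k} i≤k w w∈ = ℕₚ.<⇒<ᵇ (ℕₚ.<-≤-trans (ℕₚ.<ᵇ⇒< _ i w∈) i≤k)

prefix-transpose : ∀ {m k} (π : Permutation′ m) {a b : Fin m} → k ℕ.≤ toℕ a → k ℕ.≤ toℕ b →
                   ∀ w → prefix (Perm.transpose a b ∘ₚ π) k w ≡ prefix π k w
prefix-transpose π k≤a k≤b w = transpose-<ᵇ k≤b k≤a (π ⟨$⟩ˡ w)

-- Walks and subsets

Reach-closed : ∀ {m} {e : Fin m → Fin m → Bool} (Q : Fin m → Set) →
               (∀ {i j} → e i j ≡ true → Q i → Q j) → ∀ {i j} → Reach e i j → Q i → Q j
Reach-closed Q closed here           q = q
Reach-closed Q closed (step eij i↝k) q = Reach-closed Q closed i↝k (closed eij q)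

does-∈? : ∀ {m} (w : Fin m) (A : Subset m) → does (w Subsetₚ.∈? A) ≡ lookup A w
does-∈? zero    (true  Vec.∷ A) = refl
does-∈? zero    (false Vec.∷ A) = refl
does-∈? (suc w) (_     Vec.∷ A) = does-∈? w A

∈⇔T-lookup : ∀ {m} {w : Fin m} {A : Subset m} → w ∈ A ⇔ T (lookup A w)
∈⇔T-lookup = mk⇔ (Equivalence.from T-≡ ∘ []=⇒lookup) (lookup⇒[]= _ _ ∘ Equivalence.to T-≡)

module Toppling {n : ℕ} (G : Graph n) where
  open Graph G

  edge : Fin n → Fin n → ℤ
  edge v w = + eℕ G (inject₁ v) (inject₁ w)

  sinkEdges : Fin n → ℤ
  sinkEdges v = + eℕ G (inject₁ v) (sink G)

  degree : Fin n → ℤ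
  degree v = + deg G (inject₁ v)

  nbrsIn : Fin n → (Fin n → Bool) → ℤ
  nbrsIn v P = sumOver P (edge v)

  eℕ-sym : ∀ i j → eℕ G i j ≡ eℕ G j i
  eℕ-sym i j rewrite symmetric i j = refl

  eℕ-loop : ∀ i → eℕ G i i ≡ 0
  eℕ-loop i rewrite loopless i = refl

  edge-nonneg : ∀ v w → 0ℤ ≤ edge v w
  edge-nonneg v w = ℤ.+≤+ ℕ.z≤n

  sinkEdges-nonneg : ∀ v → 0ℤ ≤ sinkEdges v
  sinkEdges-nonneg v = ℤ.+≤+ ℕ.z≤n

  degree-split : ∀ v → degree v ≡ nbrsIn v (const true) + sinkEdges v
  degree-split v =
    trans (pos-sumℕ (eℕ G (inject₁ v)) (λ i → i)) (Sum.sum-init-last (λ u → + eℕ G (inject₁ v) u))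

  Δ-diagonal : ∀ i → Δ G i i ≡ + deg G i
  Δ-diagonal i with i Fin.≟ i
  ... | yes _   = refl
  ... | no i≢i = contradiction refl i≢i

  Δ-offdiagonal : ∀ {i j} → i ≢ j → Δ G i j ≡ - (+ eℕ G i j)
  Δ-offdiagonal {i} {j} i≢j with i Fin.≟ j
  ... | yes i≡j = contradiction i≡j i≢j
  ... | no _    = refl

  Δ-column : ∀ (P : Fin n → Bool) v w →
             (if P w then Δ G (inject₁ w) (inject₁ v) else 0ℤ) + (if P w then edge v w else 0ℤ)
               ≡ (if does (w Fin.≟ v) then (if P v then degree v else 0ℤ) else 0ℤ)
  Δ-column P v w with w Fin.≟ v | P w in Pw
  ... | yes refl | true  rewrite Pw | Δ-diagonal (inject₁ v) | eℕ-loop (inject₁ v) =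
                           ℤₚ.+-identityʳ _
  ... | yes refl | false rewrite Pw = refl
  ... | no w≢v   | true  rewrite Δ-offdiagonal (w≢v ∘ Finₚ.inject₁-injective)
                               | eℕ-sym (inject₁ w) (inject₁ v) =
                           ℤₚ.+-inverseˡ (edge v w)
  ... | no w≢v   | false = refl

  sumΔ-at : ∀ (P : Fin n → Bool) v →
            sum (λ w → if P w then Δ G (inject₁ w) (inject₁ v) else 0ℤ)
              ≡ (if P v then degree v else 0ℤ) - nbrsIn v P
  sumΔ-at P v = +-≡⇒≡- (begin
      sum (λ w → if P w then Δ G (inject₁ w) (inject₁ v) else 0ℤ) + nbrsIn v P
    ≡⟨ Sum.∑-distrib-+ (λ w → if P w then Δ G (inject₁ w) (inject₁ v) else 0ℤ) _ ⟨
      sum (λ w → (if P w then Δ G (inject₁ w) (inject₁ v) else 0ℤ) + (if P w then edge v w else 0ℤ))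
    ≡⟨ sum-cong-≗ (Δ-column P v) ⟩
      sum (λ w → if does (w Fin.≟ v) then (if P v then degree v else 0ℤ) else 0ℤ)
    ≡⟨ sum-indicator v _ ⟩
      (if P v then degree v else 0ℤ)
    ∎)
    where open ≡-Reasoning

  sumC-map-at : ∀ {A : Set} (F : A → Config G) xs i →
                sumC G (map F xs) i ≡ sumᴸ (map (λ a → F a i) xs)
  sumC-map-at F []       i = refl
  sumC-map-at F (a ∷ xs) i = cong (_+_ (F a i)) (sumC-map-at F xs i)

  ΔS-at : ∀ A v → ΔS G A (inject₁ v) ≡ (if lookup A v then degree v else 0ℤ) - nbrsIn v (lookup A)
  ΔS-at A v = begin
      ΔS G A (inject₁ v)
    ≡⟨ sumC-map-at (Δ G ∘ inject₁) (members G A) (inject₁ v) ⟩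
      sumᴸ (map Δ·v (filter (Subsetₚ._∈? A) (allFin n)))
    ≡⟨ sumᴸ-filter (Subsetₚ._∈? A) Δ·v (λ w → w) ⟩
      sum (λ w → if does (w Subsetₚ.∈? A) then Δ·v w else 0ℤ)
    ≡⟨ sum-cong-≗ (λ w → cong (λ b → if b then Δ·v w else 0ℤ) (does-∈? w A)) ⟩
      sum (λ w → if lookup A w then Δ·v w else 0ℤ)
    ≡⟨ sumΔ-at (lookup A) v ⟩
      (if lookup A v then degree v else 0ℤ) - nbrsIn v (lookup A)
    ∎
    where
    open ≡-Reasoning
    Δ·v : Fin n → ℤ
    Δ·v w = Δ G (inject₁ w) (inject₁ v)

  prefixSum : Permutation′ n → ℕ → Config G
  prefixSum π k = sumC G (take k (map (λ j → Δ G (inject₁ (π ⟨$⟩ʳ j))) (allFin n)))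

  prefixSum-at : ∀ π k v → prefixSum π k (inject₁ v)
                         ≡ (if prefix π k v then degree v else 0ℤ) - nbrsIn v (prefix π k)
  prefixSum-at π k v = begin
      prefixSum π k (inject₁ v)
    ≡⟨ cong (λ xs → sumC G xs (inject₁ v)) (Listₚ.take-map k (allFin n)) ⟩
      sumC G (map (Δ G ∘ inject₁ ∘ (π ⟨$⟩ʳ_)) (take k (allFin n))) (inject₁ v)
    ≡⟨ sumC-map-at (Δ G ∘ inject₁ ∘ (π ⟨$⟩ʳ_)) (take k (allFin n)) (inject₁ v) ⟩
      sumᴸ (map (Δ·v ∘ (π ⟨$⟩ʳ_)) (take k (allFin n)))
    ≡⟨ sumᴸ-take k (Δ·v ∘ (π ⟨$⟩ʳ_)) (λ j → j) ⟩
      sum (λ j → if toℕ j ℕ.<ᵇ k then Δ·v (π ⟨$⟩ʳ j) else 0ℤ)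
    ≡⟨ Sum.∑-permute _ (Perm.flip π) ⟩
      sum (λ w → if prefix π k w then Δ·v (π ⟨$⟩ʳ (π ⟨$⟩ˡ w)) else 0ℤ)
    ≡⟨ sum-cong-≗ (λ w → cong (λ u → if prefix π k w then Δ·v u else 0ℤ)
                             (Perm.inverseʳ π)) ⟩
      sum (λ w → if prefix π k w then Δ·v w else 0ℤ)
    ≡⟨ sumΔ-at (prefix π k) v ⟩
      (if prefix π k v then degree v else 0ℤ) - nbrsIn v (prefix π k)
    ∎
    where
    open ≡-Reasoning
    Δ·v : Fin n → ℤ
    Δ·v w = Δ G (inject₁ w) (inject₁ v)

  Δsink-at : ∀ v → Δ G (sink G) (inject₁ v) ≡ - sinkEdges v
  Δsink-at v =
    trans (Δ-offdiagonal Finₚ.fromℕ≢inject₁) (cong (λ k → - (+ k)) (eℕ-sym (sink G) (inject₁ v)))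

  ΔS-nonvanishing : ∀ A → Nonempty A → ¬ (∀ v → ΔS G A (inject₁ v) ≡ 0ℤ)
  ΔS-nonvanishing A (v₀ , v₀∈A) ΔA≡0 = Finₚ.fromℕ≢inject₁ (sym (proj₂ (proj₂ reached)))
    where
    Inside : Fin (ℕ.suc n) → Set
    Inside i = ∃ λ w → T (lookup A w) × inject₁ w ≡ i

    -- At v ∈ A, Δ_A counts the edges from v that leave A.
    no-exit : ∀ v → T (lookup A v) → sinkEdges v + nbrsIn v (not ∘ lookup A) ≡ 0ℤ
    no-exit v v∈A = begin
        s + b
      ≡⟨ rearrange a b s ⟩
        a + b + s - a
      ≡⟨ cong (λ x → x + s - a) (sumOver-complement (lookup A) (edge v)) ⟩
        nbrsIn v (const true) + s - a
      ≡⟨ cong (_- a) (trans (if-T v∈A) (degree-split v)) ⟨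
        (if lookup A v then degree v else 0ℤ) - a
      ≡⟨ ΔS-at A v ⟨
        ΔS G A (inject₁ v)
      ≡⟨ ΔA≡0 v ⟩
        0ℤ
      ∎
      where
      open ≡-Reasoning
      s = sinkEdges v
      a = nbrsIn v (lookup A)
      b = nbrsIn v (not ∘ lookup A)
      rearrange : ∀ a b s → s + b ≡ a + b + s - a
      rearrange = solve-∀

    positive-sum : ∀ {x y} → 0ℤ ≤ x → 0ℤ ≤ y → 1ℤ ≤ x ⊎ 1ℤ ≤ y → x + y ≢ 0ℤ
    positive-sum 0≤x 0≤y (inj₁ 1≤x) x+y≡0 with subst (1ℤ ≤_) x+y≡0 (ℤₚ.+-mono-≤ 1≤x 0≤y)
    ... | ℤ.+≤+ ()
    positive-sum 0≤x 0≤y (inj₂ 1≤y) x+y≡0 with subst (1ℤ ≤_) x+y≡0 (ℤₚ.+-mono-≤ 0≤x 1≤y)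
    ... | ℤ.+≤+ ()

    no-edge-to-sink : ∀ v → T (lookup A v) → e (inject₁ v) (sink G) ≢ true
    no-edge-to-sink v v∈A ev = positive-sum (sinkEdges-nonneg v) (sumOver-nonneg (edge-nonneg v) _)
                                 (inj₁ 1≤sinkEdges) (no-exit v v∈A)
      where
      1≤sinkEdges : 1ℤ ≤ sinkEdges v
      1≤sinkEdges rewrite ev = ℤₚ.≤-refl

    edge-stays-inside : ∀ v w → T (lookup A v) → e (inject₁ v) (inject₁ w) ≡ true → T (lookup A w)
    edge-stays-inside v w v∈A evw with lookup A w in Aw
    ... | true  = _
    ... | false = positive-sum (sinkEdges-nonneg v) (sumOver-nonneg (edge-nonneg v) _)
                    (inj₂ 1≤nbrs) (no-exit v v∈A)
      where
      1≤edge : 1ℤ ≤ edge v w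
      1≤edge rewrite evw = ℤₚ.≤-refl
      1≤nbrs : 1ℤ ≤ nbrsIn v (not ∘ lookup A)
      1≤nbrs = ℤₚ.≤-trans 1≤edge (term≤sumOver (edge-nonneg v) w (subst (T ∘ not) (sym Aw) _))

    closed : ∀ {i j} → e i j ≡ true → Inside i → Inside j
    closed {j = j} eij (v , v∈A , refl) with n ℕ.≟ toℕ j
    ... | yes n≡j =
      contradiction (subst (λ k → e (inject₁ v) k ≡ true) j≡sink eij) (no-edge-to-sink v v∈A)
      where
      j≡sink : j ≡ sink G
      j≡sink = Finₚ.toℕ-injective (trans (sym n≡j) (sym (Finₚ.toℕ-fromℕ n)))
    ... | no n≢j =
      lower₁ j n≢j , edge-stays-inside v _ v∈A (subst (λ k → e (inject₁ v) k ≡ true) (sym ι⁻¹j) eij)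
                   , ι⁻¹j
      where
      ι⁻¹j : inject₁ (lower₁ j n≢j) ≡ j
      ι⁻¹j = Finₚ.inject₁-lower₁ j n≢j

    reached : Inside (sink G)
    reached = Reach-closed Inside closed (connected (inject₁ v₀) (sink G))
                (v₀ , Equivalence.to ∈⇔T-lookup v₀∈A , refl)

  T-nonemptyᵇ : ∀ A → T (nonemptyᵇ G A) ⇔ Nonempty A
  T-nonemptyᵇ A = mk⇔ to from
    where
    to : T (nonemptyᵇ G A) → Nonempty A
    to _ with members G A in eq
    ... | w ∷ _ =
      w , proj₂ (∈-filter⁻ (Subsetₚ._∈? A) {xs = allFin n} (subst (w ∈ˡ_) (sym eq) (here refl)))
    from : Nonempty A → T (nonemptyᵇ G A)
    from (w , w∈A) with members G A in eq
    ... | _ ∷ _ = _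
    ... | []    with () ← subst (w ∈ˡ_) eq (∈-filter⁺ (Subsetₚ._∈? A) (∈-allFin w) w∈A)

  T-stableᵇ : ∀ x → T (stableᵇ G x) ⇔ Stable G x
  T-stableᵇ x = mk⇔ (tabulate⁻ ∘ Equivalence.to (T-foldr (allFin n)))
                    (Equivalence.from (T-foldr (allFin n)) ∘ tabulate⁺)
    where
    Bounded : Fin n → Set
    Bounded i = (0ℤ ≤ x (inject₁ i)) × (x (inject₁ i) < + deg G (inject₁ i))
    T-foldr : ∀ is → T (foldr (λ i b → does (0ℤ ℤₚ.≤? x (inject₁ i))
                                     ∧ does (x (inject₁ i) ℤₚ.<? + deg G (inject₁ i)) ∧ b) true is)
                     ⇔ All Bounded is
    T-foldr []       = mk⇔ (λ _ → []) (λ _ → _)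
    T-foldr (i ∷ is) with 0ℤ ℤₚ.≤? x (inject₁ i) | x (inject₁ i) ℤₚ.<? + deg G (inject₁ i)
    ... | yes p | yes q = mk⇔ (λ t → (p , q) ∷ Equivalence.to (T-foldr is) t)
                              (λ { (_ ∷ bs) → Equivalence.from (T-foldr is) bs })
    ... | yes _ | no ¬q = mk⇔ (λ ()) (λ { ((_ , q) ∷ _) → ¬q q })
    ... | no ¬p | _     = mk⇔ (λ ()) (λ { ((p , _) ∷ _) → ¬p p })

  ∈-allSubsets : ∀ {m} (A : Subset m) → A ∈ˡ allSubsets G m
  ∈-allSubsets Vec.[]            = here refl
  ∈-allSubsets {ℕ.suc m} (false Vec.∷ A) =
    ∈-++⁺ˡ (∈-map⁺ (false Vec.∷_) (∈-allSubsets A))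
  ∈-allSubsets {ℕ.suc m} (true  Vec.∷ A) =
    ∈-++⁺ʳ (map (false Vec.∷_) (allSubsets G m)) (∈-map⁺ (true Vec.∷_) (∈-allSubsets A))

  minimum≺-∈ : ∀ As {A} → minimum≺ G As ≡ just A → A ∈ˡ As
  minimum≺-∈ (B ∷ As) eq with minimum≺ G As in eqAs
  ... | nothing = here (sym (Maybeₚ.just-injective eq))
  ... | just C with _≺ᵇ_ G C B
  ...   | true  = there (minimum≺-∈ As (trans eqAs eq))
  ...   | false = here (sym (Maybeₚ.just-injective eq))

  minimum≺-nothing : ∀ As → minimum≺ G As ≡ nothing → As ≡ []
  minimum≺-nothing []       _  = refl
  minimum≺-nothing (B ∷ As) eq with minimum≺ G As
  ... | nothing with () ← eq
  ... | just C with _≺ᵇ_ G C B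
  ...   | true  with () ← eq
  ...   | false with () ← eq

module Firing {n : ℕ} (G : Graph n) (c : Config G) where
  open Toppling G

  c+Δ[_] : Subset n → Config G
  c+Δ[ A ] = _⊕_ G c (ΔS G A)

  CanTopple : (Fin n → Bool) → Fin n → Set
  CanTopple P v = degree v ≤ c (inject₁ v) + sinkEdges v + nbrsIn v P

  CanTopple? : ∀ P v → Dec (CanTopple P v)
  CanTopple? P v = degree v ℤₚ.≤? c (inject₁ v) + sinkEdges v + nbrsIn v P

  CanTopple-cong : ∀ {P Q} → (∀ w → P w ≡ Q w) → ∀ {v} → CanTopple P v → CanTopple Q v
  CanTopple-cong P≗Q {v} =
    subst (λ N → degree v ≤ c (inject₁ v) + sinkEdges v + N) (sumOver-cong (edge v) P≗Q)

  -- The value at v once the sink and then every vertex of P have toppled.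
  afterFiring : (Fin n → Bool) → Fin n → ℤ
  afterFiring P v = c (inject₁ v) + sinkEdges v + nbrsIn v P - (if P v then degree v else 0ℤ)

  afterFiring-nonneg : ∀ {P v} → 0ℤ ≤ c (inject₁ v) →
                       (T (P v) → ∃ λ Q → Q ⊆ᵇ P × CanTopple Q v) → 0ℤ ≤ afterFiring P v
  afterFiring-nonneg {P} {v} 0≤c fired with P v
  ... | false = subst (0ℤ ≤_) (sym (ℤₚ.+-identityʳ _))
                  (ℤₚ.+-mono-≤ (ℤₚ.+-mono-≤ 0≤c (sinkEdges-nonneg v)) (sumOver-nonneg (edge-nonneg v) P))
  ... | true with fired _
  ...   | Q , Q⊆P , topples =
    ℤₚ.i≤j⇒0≤j-i (ℤₚ.≤-trans topples (ℤₚ.+-monoʳ-≤ (c (inject₁ v) + sinkEdges v)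
                                                     (sumOver-mono (edge-nonneg v) Q⊆P)))

  afterFiring<degree : ∀ {P v} → c (inject₁ v) < degree v →
                       (¬ T (P v) → ¬ CanTopple P v) → afterFiring P v < degree v
  afterFiring<degree {P} {v} c<d stuck with P v
  ... | false = subst (_< degree v) (sym (ℤₚ.+-identityʳ _)) (ℤₚ.≰⇒> (stuck λ ()))
  ... | true  = begin-strict
      cᵥ + s + nbrsIn v P - d ≤⟨ ℤₚ.+-monoˡ-≤ (- d) (ℤₚ.+-monoʳ-≤ (cᵥ + s) P≤all) ⟩
      cᵥ + s + all - d        ≡⟨ cong (λ x → cᵥ + s + all - x) (degree-split v) ⟩
      cᵥ + s + all - (all + s) ≡⟨ cancel cᵥ s all ⟩
      cᵥ                      <⟨ c<d ⟩
      d                       ∎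
    where
    open ℤₚ.≤-Reasoning
    cᵥ = c (inject₁ v)
    s = sinkEdges v
    d = degree v
    all = nbrsIn v (const true)
    P≤all : nbrsIn v P ≤ all
    P≤all = sumOver-mono (edge-nonneg v) {Q = const true} (λ _ _ → _)
    cancel : ∀ c s a → c + s + a - (a + s) ≡ c
    cancel = solve-∀

  recurrence-at : ∀ π k v → _⊖_ G (_⊖_ G c (Δ G (sink G))) (prefixSum π k) (inject₁ v)
                            ≡ afterFiring (prefix π k) v
  recurrence-at π k v =
    trans (cong₂ (λ x y → c (inject₁ v) - x - y) (Δsink-at v) (prefixSum-at π k v))
          (rearrange (c (inject₁ v)) (sinkEdges v) (nbrsIn v (prefix π k)) _)
    where
    rearrange : ∀ c s a x → c - - s - (x - a) ≡ c + s + a - x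
    rearrange = solve-∀

  -- Since the Δ_i of all n + 1 vertices sum to zero, c + Δ_{∁P} agrees with c − Δ_sink − Δ_P
  -- off the sink.
  ΔS-complement-at : ∀ P v → c+Δ[ Vec.tabulate (not ∘ P) ] (inject₁ v) ≡ afterFiring P v
  ΔS-complement-at P v = begin
      cᵥ + ΔS G (Vec.tabulate (not ∘ P)) (inject₁ v)
    ≡⟨ cong (_+_ cᵥ) (ΔS-at _ v) ⟩
      cᵥ + ((if lookup (Vec.tabulate (not ∘ P)) v then d else 0ℤ)
             - nbrsIn v (lookup (Vec.tabulate (not ∘ P))))
    ≡⟨ cong₂ (λ x N → cᵥ + ((if x then d else 0ℤ) - N))
             (lookup∘tabulate (not ∘ P) v) (sumOver-cong (edge v) (lookup∘tabulate (not ∘ P))) ⟩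
      cᵥ + ((if not (P v) then d else 0ℤ) - b)
    ≡⟨ by-cases ⟩
      afterFiring P v
    ∎
    where
    open ≡-Reasoning
    cᵥ = c (inject₁ v)
    s = sinkEdges v
    d = degree v
    a = nbrsIn v P
    b = nbrsIn v (not ∘ P)
    d≡a+b+s : d ≡ a + b + s
    d≡a+b+s = trans (degree-split v) (cong (_+ s) (sym (sumOver-complement P (edge v))))
    by-cases : cᵥ + ((if not (P v) then d else 0ℤ) - b) ≡ afterFiring P v
    by-cases with P v
    ... | true  = trans (fired cᵥ s a b) (cong (λ x → cᵥ + s + a - x) (sym d≡a+b+s))
      where
      fired : ∀ c s a b → c + (0ℤ - b) ≡ c + s + a - (a + b + s)
      fired = solve-∀
    ... | false = trans (cong (λ x → cᵥ + (x - b)) d≡a+b+s) (unfired cᵥ s a b)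
      where
      unfired : ∀ c s a b → c + (a + b + s - b) ≡ c + s + a - 0ℤ
      unfired = solve-∀

  Candidate : Subset n → Set
  Candidate A = Nonempty A × Stable G c+Δ[ A ]

  firing-blocks-stability : ∀ {P Q v} → T (P v) → (∀ w → T (P w) → T (Q w) → w ≡ v) →
                            0ℤ ≤ afterFiring P v → degree v ≤ c (inject₁ v) + (degree v - nbrsIn v Q)
  firing-blocks-stability {P} {Q} {v} v∈P meet 0≤fired = begin
      d                    ≤⟨ ℤₚ.0≤i-j⇒j≤i (subst (0ℤ ≤_) (cong (λ x → cᵥ + s + a - x) (if-T v∈P)) 0≤fired) ⟩
      cᵥ + s + a           ≡⟨ rearrange cᵥ s a b ⟩
      cᵥ + (a + b + s - b) ≤⟨ ℤₚ.+-monoʳ-≤ cᵥ (ℤₚ.+-monoˡ-≤ (- b) a+b+s≤d) ⟩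
      cᵥ + (d - b)         ∎
    where
    open ℤₚ.≤-Reasoning
    cᵥ = c (inject₁ v)
    s = sinkEdges v
    d = degree v
    a = nbrsIn v P
    b = nbrsIn v Q
    rearrange : ∀ c s a b → c + s + a ≡ c + (a + b + s - b)
    rearrange = solve-∀
    a+b≤all : a + b ≤ nbrsIn v (const true)
    a+b≤all = sumOver-disjoint (edge-nonneg v)
                (λ w w∈P w∈Q → trans (cong (edge v) (meet w w∈P w∈Q)) (cong +_ (eℕ-loop (inject₁ v))))
    a+b+s≤d : a + b + s ≤ d
    a+b+s≤d = subst (a + b + s ≤_) (sym (degree-split v)) (ℤₚ.+-monoˡ-≤ s a+b≤all)

  recurrent⇒noCandidate : Recurrent G c → ∀ A → ¬ Candidate A
  recurrent⇒noCandidate (_ , π , legal) A ((w , w∈A) , stable) =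
    ℤₚ.≤⇒≯ (firing-blocks-stability v∈P meet 0≤fired) unstable
    where
    A-along-π : Fin n → Set
    A-along-π j = T (lookup A (π ⟨$⟩ʳ j))

    w∈A-along-π : A-along-π (π ⟨$⟩ˡ w)
    w∈A-along-π = subst (T ∘ lookup A) (sym (Perm.inverseʳ π)) (Equivalence.to ∈⇔T-lookup w∈A)

    first = Finₚ.¬∀⟶∃¬-smallest n (¬_ ∘ A-along-π) (λ j → ¬? (T? _)) (λ none → none _ w∈A-along-π)
    i = proj₁ first
    v = π ⟨$⟩ʳ i
    P = prefix π (ℕ.suc (toℕ i))

    v∈A : T (lookup A v)
    v∈A = decidable-stable (T? _) (proj₁ (proj₂ first))

    v∈P : T (P v)
    v∈P rewrite Perm.inverseˡ π {i} = ℕₚ.<⇒<ᵇ (ℕₚ.n<1+n (toℕ i))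

    meet : ∀ u → T (P u) → T (lookup A u) → u ≡ v
    meet u u∈P u∈A with ℕₚ.m≤n⇒m<n∨m≡n (ℕₚ.m<1+n⇒m≤n (ℕₚ.<ᵇ⇒< _ _ u∈P))
    ... | inj₁ earlier = contradiction (subst (T ∘ lookup A) (sym (Perm.inverseʳ π)) u∈A)
                           (subst (¬_ ∘ A-along-π) j≡π⁻¹u (proj₂ (proj₂ first) j))
      where
      j = fromℕ< earlier
      j≡π⁻¹u : inject j ≡ π ⟨$⟩ˡ u
      j≡π⁻¹u = Finₚ.toℕ-injective (trans (Finₚ.toℕ-inject j) (Finₚ.toℕ-fromℕ< earlier))
    ... | inj₂ same = trans (sym (Perm.inverseʳ π)) (cong (π ⟨$⟩ʳ_) (Finₚ.toℕ-injective same))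

    0≤fired : 0ℤ ≤ afterFiring P v
    0≤fired = subst (0ℤ ≤_) (recurrence-at π (ℕ.suc (toℕ i)) v) (legal (suc i) v)

    unstable : c (inject₁ v) + (degree v - nbrsIn v (lookup A)) < degree v
    unstable = subst (λ x → c (inject₁ v) + x < degree v)
                     (trans (ΔS-at A v) (cong (_- nbrsIn v (lookup A)) (if-T v∈A)))
                     (proj₂ (stable v))

  LegalPrefix : Permutation′ n → ℕ → Set
  LegalPrefix π k = ∀ j → toℕ j ℕ.< k → CanTopple (prefix π (toℕ j)) (π ⟨$⟩ʳ j)

  legal⇒afterFiring-nonneg : Stable G c → ∀ {π k i} → LegalPrefix π k → i ℕ.≤ k →
                             ∀ v → 0ℤ ≤ afterFiring (prefix π i) v
  legal⇒afterFiring-nonneg st {π} {k} {i} legal i≤k v = afterFiring-nonneg (proj₁ (st v)) fired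
    where
    j = π ⟨$⟩ˡ v
    fired : T (prefix π i v) → ∃ λ Q → Q ⊆ᵇ prefix π i × CanTopple Q v
    fired v∈ = prefix π (toℕ j) , prefix-mono π (ℕₚ.<⇒≤ j<i)
             , subst (CanTopple (prefix π (toℕ j))) (Perm.inverseʳ π) (legal j (ℕₚ.<-≤-trans j<i i≤k))
      where
      j<i = ℕₚ.<ᵇ⇒< (toℕ j) i v∈

  LegalPrefix-extend : ∀ {π k v} → LegalPrefix π k → (k<n : k ℕ.< n) →
                       ¬ T (prefix π k v) → CanTopple (prefix π k) v →
                       LegalPrefix (Perm.transpose (fromℕ< k<n) (π ⟨$⟩ˡ v) ∘ₚ π) (ℕ.suc k)
  LegalPrefix-extend {π} {k} {v} legal k<n v∉P topples = extended
    where
    a = fromℕ< k<n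
    b = π ⟨$⟩ˡ v
    k≤a : k ℕ.≤ toℕ a
    k≤a = ℕₚ.≤-reflexive (sym (Finₚ.toℕ-fromℕ< k<n))
    k≤b : k ℕ.≤ toℕ b
    k≤b = ℕₚ.≮⇒≥ (v∉P ∘ ℕₚ.<⇒<ᵇ)

    π′ = Perm.transpose a b ∘ₚ π

    topples-at-a : CanTopple (prefix π′ (toℕ a)) (π′ ⟨$⟩ʳ a)
    topples-at-a = subst₂ (λ i u → CanTopple (prefix π′ i) u)
                     (sym (Finₚ.toℕ-fromℕ< k<n))
                     (sym (trans (cong (π ⟨$⟩ʳ_) (transpose-matchˡ a b)) (Perm.inverseʳ π)))
                     (CanTopple-cong (sym ∘ prefix-transpose π k≤a k≤b) topples)

    extended : LegalPrefix π′ (ℕ.suc k)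
    extended j j<1+k with ℕₚ.m≤n⇒m<n∨m≡n (ℕₚ.m<1+n⇒m≤n j<1+k)
    ... | inj₁ j<k =
      CanTopple-cong (sym ∘ prefix-transpose π (ℕₚ.≤-trans j≤k k≤a) (ℕₚ.≤-trans j≤k k≤b))
        (subst (CanTopple _) (cong (π ⟨$⟩ʳ_) (sym (transpose-≢ j≢a j≢b))) (legal j j<k))
      where
      j≤k = ℕₚ.<⇒≤ j<k
      j≢a : j ≢ a
      j≢a refl = ℕₚ.<-irrefl (Finₚ.toℕ-fromℕ< k<n) j<k
      j≢b : j ≢ b
      j≢b refl = ℕₚ.<⇒≱ j<k k≤b
    ... | inj₂ j≡k = subst (λ j → CanTopple (prefix π′ (toℕ j)) (π′ ⟨$⟩ʳ j)) (sym j≡a) topples-at-a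
      where
      j≡a : j ≡ a
      j≡a = Finₚ.toℕ-injective (trans j≡k (sym (Finₚ.toℕ-fromℕ< k<n)))

  stuck⇒Candidate : Stable G c → ∀ {π k} → LegalPrefix π k → (k<n : k ℕ.< n) →
                    (∀ v → ¬ T (prefix π k v) → ¬ CanTopple (prefix π k) v) →
                    Candidate (Vec.tabulate (not ∘ prefix π k))
  stuck⇒Candidate st {π} {k} legal k<n stuck = (next , next∉P) , stable
    where
    P = prefix π k
    next = π ⟨$⟩ʳ fromℕ< k<n

    next∉P : next ∈ Vec.tabulate (not ∘ P)
    next∉P = Equivalence.from ∈⇔T-lookup (subst T (sym (lookup∘tabulate (not ∘ P) next))
               (subst (T ∘ not) (sym (≤⇒≮ᵇ k≤next)) _))
      where
      k≤next : k ℕ.≤ toℕ (π ⟨$⟩ˡ next)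
      k≤next rewrite Perm.inverseˡ π {fromℕ< k<n} = ℕₚ.≤-reflexive (sym (Finₚ.toℕ-fromℕ< k<n))

    stable : Stable G c+Δ[ Vec.tabulate (not ∘ P) ]
    stable v = subst (λ x → (0ℤ ≤ x) × (x < degree v)) (sym (ΔS-complement-at P v))
                 ( legal⇒afterFiring-nonneg st {π} {k} {k} legal ℕₚ.≤-refl v
                 , afterFiring<degree (proj₂ (st v)) (stuck v))

  noCandidate⇒recurrent : Stable G c → (∀ A → ¬ Candidate A) → Recurrent G c
  noCandidate⇒recurrent st none = st , π , λ i v →
    subst (0ℤ ≤_) (sym (recurrence-at π (toℕ i) v))
          (legal⇒afterFiring-nonneg st {π} {n} {toℕ i} legal (Finₚ.toℕ≤pred[n] i) v)
    where
    burn : ∀ k → k ℕ.≤ n → Σ (Permutation′ n) λ π → LegalPrefix π k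
    burn ℕ.zero    _   = Perm.id , λ _ ()
    burn (ℕ.suc k) k<n with burn k (ℕₚ.<⇒≤ k<n)
    ... | π , legal with Finₚ.any? (λ v → ¬? (T? (prefix π k v)) ×-dec CanTopple? (prefix π k) v)
    ...   | yes (v , v∉P , topples) =
      Perm.transpose (fromℕ< k<n) (π ⟨$⟩ˡ v) ∘ₚ π , LegalPrefix-extend {π} {k} {v} legal k<n v∉P topples
    ...   | no stuck =
      ⊥-elim (none _ (stuck⇒Candidate st {π} {k} legal k<n (λ v v∉P topples → stuck (v , v∉P , topples))))
    π = proj₁ (burn n ℕₚ.≤-refl)
    legal = proj₂ (burn n ℕₚ.≤-refl)

  candidateᵇ : Subset n → Bool
  candidateᵇ A = nonemptyᵇ G A ∧ stableᵇ G c+Δ[ A ]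

  T-candidateᵇ : ∀ A → T (candidateᵇ A) ⇔ Candidate A
  T-candidateᵇ A = mk⇔
    (λ t → let (ne , st) = Equivalence.to T-∧ t
           in Equivalence.to (T-nonemptyᵇ A) ne , Equivalence.to (T-stableᵇ c+Δ[ A ]) st)
    (λ (ne , st) → Equivalence.from T-∧
                     (Equivalence.from (T-nonemptyᵇ A) ne , Equivalence.from (T-stableᵇ c+Δ[ A ]) st))

  candidates : List (Subset n)
  candidates = filterᵇ candidateᵇ (allSubsets G n)

  -- Only whether a candidate exists matters, not the ≺-minimality of the one ψ picks.
  ψ-cases : (ψ G c ≡ c × (∀ A → ¬ Candidate A)) ⊎ (∃ λ A → Candidate A × ψ G c ≡ c+Δ[ A ])
  ψ-cases with minimum≺ G candidates in eq
  ... | nothing = inj₁ (refl , none)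
    where
    none : ∀ A → ¬ Candidate A
    none A cand with () ← subst (A ∈ˡ_) (minimum≺-nothing candidates eq)
                            (∈-filter⁺ (T? ∘ candidateᵇ) (∈-allSubsets A)
                                       (Equivalence.from (T-candidateᵇ A) cand))
  ... | just A = inj₂ (A , Equivalence.to (T-candidateᵇ A) (proj₂ A∈) , refl)
    where
    A∈ = ∈-filter⁻ (T? ∘ candidateᵇ) {xs = allSubsets G n} (minimum≺-∈ candidates eq)

  fixed⇒noCandidate : _≈_ G (ψ G c) c → ∀ A → ¬ Candidate A
  fixed⇒noCandidate fixed with ψ-cases
  ... | inj₁ (_ , none)                = none
  ... | inj₂ (A , (nonempty , _) , ψ≡) = ⊥-elim (ΔS-nonvanishing A nonempty λ v →
          x+y≡x⇒y≡0 (trans (cong (λ x → x (inject₁ v)) (sym ψ≡)) (fixed v)))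

  noCandidate⇒fixed : (∀ A → ¬ Candidate A) → _≈_ G (ψ G c) c
  noCandidate⇒fixed none with ψ-cases
  ... | inj₁ (ψ≡ , _)       = λ v → cong (λ x → x (inject₁ v)) ψ≡
  ... | inj₂ (A , cand , _) = ⊥-elim (none A cand)

theorem2p4 : ∀ (n : ℕ) (G : Graph n) (c : Config G) →
    Stable G c → (_≈_ G (ψ G c) c ⇔ Recurrent G c)
theorem2p4 n G c stable = mk⇔
  (noCandidate⇒recurrent stable ∘ fixed⇒noCandidate)
  (noCandidate⇒fixed ∘ recurrent⇒noCandidate)
  where open Firing G c
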